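{- Let $G$ be a graph with no isolated vertex that is not a disjoint union of copies of $K_2$, and let $H$ be any nontrivial graph with root $v\in V(H)$. Then $\gamma_R(G\circ_v H)=n(G)\gamma_R(H)$ if and only if $\gamma_R(H-v)\geq\gamma_R(H)$.
   Context: All graphs are finite and simple; a graph is nontrivial if it has at least two vertices; $n(G)=|V(G)|$; $K_2$ is the graph with one edge. For a graph $G$ and a nontrivial graph $H$ with a root $v\in V(H)$, the rooted product graph $G\circ_v H$ is obtained by taking one copy of $G$ and $n(G)$ copies of $H$, and identifying the $i$-th vertex of $G$ with the vertex $v$ in the $i$-th copy of $H$, for each $i$. $H-v$ is $H$ with $v$ deleted. A Roman dominating function on a graph $X$ is $f:V(X)\to\{0,1,2\}$ such that every vertex with value $0$ has a neighbor with value $2$; its weight is $\sum_u f(u)$, and $\gamma_R(X)$ is the minimum weight of such $f$. -}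

module Defs where

open import Data.Nat using (ℕ; zero; suc; _+_; _*_; _≤_)
open import Data.Fin using (Fin; zero; suc; punchIn; remQuot)
open import Data.Product using (Σ; ∃; _×_; _,_; proj₁; proj₂)
open import Data.Sum using (_⊎_)
open import Relation.Binary.PropositionalEquality using (_≡_)
open import Relation.Nullary using (¬_)

record Graph (n : ℕ) : Set₁ where
  field
    Adj     : Fin n → Fin n → Set
    sym     : ∀ {u w} → Adj u w → Adj w u
    irrefl  : ∀ {u} → ¬ Adj u u
open Graph public

NoIsolated : ∀ {n} → Graph n → Set
NoIsolated {n} G = ∀ (u : Fin n) → ∃ λ w → Adj G u w

-- G is a disjoint union of copies of K₂: every vertex has exactly one
-- neighbour (each component is then a single edge).
DisjointUnionK2 : ∀ {n} → Graph n → Set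
DisjointUnionK2 {n} G =
  ∀ (u : Fin n) → ∃ λ w → Adj G u w × (∀ w' → Adj G u w' → w' ≡ w)

deleteVertex : ∀ {k} → Graph (suc k) → Fin (suc k) → Graph k
deleteVertex H v = record
  { Adj    = λ a b → Adj H (punchIn v a) (punchIn v b)
  ; sym    = sym H
  ; irrefl = irrefl H
  }

-- Rooted product G ∘_v H on Fin (n * m): the vertex with remQuot = (i , x)
-- is vertex x of the i-th copy of H; vertex (i , v) is identified with the
-- i-th vertex of G.
RPAdj : ∀ {n m} → Graph n → Graph m → Fin m → Fin n × Fin m → Fin n × Fin m → Set
RPAdj G H v (i , x) (j , y) =
  (i ≡ j × Adj H x y) ⊎ (x ≡ v × y ≡ v × Adj G i j)

rootedProduct : ∀ {n m} → Graph n → Graph m → Fin m → Graph (n * m)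
rootedProduct {n} {m} G H v = record
  { Adj    = λ a b → RPAdj G H v (remQuot m a) (remQuot m b)
  ; sym    = symRP
  ; irrefl = irrRP
  }
  where
  open import Data.Sum using (inj₁; inj₂)
  open import Relation.Binary.PropositionalEquality as Eq using (refl)
  symRP : ∀ {a b} → RPAdj G H v (remQuot m a) (remQuot m b)
                  → RPAdj G H v (remQuot m b) (remQuot m a)
  symRP (inj₁ (p , q))     = inj₁ (Eq.sym p , sym H q)
  symRP (inj₂ (p , q , r)) = inj₂ (q , p , sym G r)
  irrRP : ∀ {a} → ¬ RPAdj G H v (remQuot m a) (remQuot m a)
  irrRP (inj₁ (_ , q))     = irrefl H q
  irrRP (inj₂ (_ , _ , r)) = irrefl G r

sumFin : ∀ {n} → (Fin n → ℕ) → ℕ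
sumFin {zero}  f = 0
sumFin {suc n} f = f zero + sumFin (λ i → f (suc i))

IsRDF : ∀ {n} → Graph n → (Fin n → ℕ) → Set
IsRDF {n} G f =
  (∀ u → f u ≤ 2) × (∀ u → f u ≡ 0 → ∃ λ w → Adj G u w × f w ≡ 2)

weight : ∀ {n} → (Fin n → ℕ) → ℕ
weight = sumFin

IsRomanDomNumber : ∀ {n} → Graph n → ℕ → Set
IsRomanDomNumber {n} G k =
  (∃ λ (f : Fin n → ℕ) → IsRDF G f × weight f ≡ k)
  × (∀ (f : Fin n → ℕ) → IsRDF G f → k ≤ weight f)

-- Copying an optimal RDF of H into every copy gives γR(G ∘ᵥ H) ≤ n γR(H).
-- Conversely an RDF of the product restricts, on each copy of H, to a function
-- that is Roman dominating except possibly at the root: if the root value is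
-- nonzero it is an RDF of H, and otherwise it restricts to an RDF of H - v; so
-- every copy weighs at least min(γR(H), γR(H - v)), which gives equality when
-- γR(H - v) ≥ γR(H).  Always γR(H) ≤ γR(H - v) + 1 (put 1 on the root).  If
-- γR(H) = γR(H - v) + 1 and a vertex u of G has two distinct neighbours w₁, w₂,
-- use an optimal RDF of H - v with 2 on the root in copy u, the same with 0 on
-- the root in copies w₁ and w₂ (their roots are dominated by the root of copy u),
-- and an optimal RDF of H elsewhere: this weighs n γR(H) - 1.  Finally, a graph
-- without isolated vertices in which no vertex has two neighbours is a disjoint
-- union of copies of K₂.
module Submission where

open import Defs hiding (sym)
open import Data.Bool.Base using (if_then_else_)
open import Data.Nat using (ℕ; zero; suc; _+_; _*_; _≥_; _≤_; _<_; z≤n; s≤s; _≤?_)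
open import Data.Nat.Properties
  using (+-0-commutativeMonoid; +-assoc; +-mono-≤; *-zeroʳ; m≤n+m; suc-injective; ≤-refl;
         ≤-reflexive; ≤-antisym; ≤-<-trans; <-irrefl; ≰⇒>; module ≤-Reasoning)
  renaming (_≟_ to _≟ℕ_)
open import Algebra.Properties.CommutativeMonoid.Sum +-0-commutativeMonoid
  using (sum; sum-cong-≗; sum-remove; ∑-distrib-+)
open import Data.Fin using (Fin; zero; suc; punchIn; punchOut; remQuot; combine; _↑ˡ_; _↑ʳ_; _≟_)
open import Data.Fin.Properties using (remQuot-combine; combine-remQuot; punchInᵢ≢i; punchIn-punchOut)
open import Data.Vec.Functional using (insertAt; removeAt)
open import Data.Vec.Functional.Properties using (insertAt-lookup; insertAt-punchIn)
open import Data.Product using (_×_; _,_; proj₁; proj₂; ∃; uncurry)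
open import Data.Sum using (_⊎_; inj₁; inj₂)
open import Function using (_∘_)
open import Relation.Binary.PropositionalEquality
  using (_≡_; _≢_; _≗_; refl; sym; trans; cong; cong₂; subst; module ≡-Reasoning)
open import Relation.Nullary using (¬_; Dec; yes; no; does; contradiction)
open import Relation.Nullary.Decidable using (dec-true; dec-false; decidable-stable)

Adj⇒≢ : ∀ {n} (G : Graph n) {x y} → Adj G x y → x ≢ y
Adj⇒≢ G xy refl = irrefl G xy

[_] : ∀ {A : Set} → Dec A → ℕ
[ d ] = if does d then 1 else 0

δ : ∀ {n} → Fin n → Fin n → ℕ
δ j i = [ i ≟ j ]

weight≡sum : ∀ {n} (f : Fin n → ℕ) → weight f ≡ sum f
weight≡sum {zero}  f = refl
weight≡sum {suc n} f = cong (f zero +_) (weight≡sum (f ∘ suc))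

weight-cong : ∀ {n} {f g : Fin n → ℕ} → f ≗ g → weight f ≡ weight g
weight-cong {f = f} {g} f≗g =
  trans (weight≡sum f) (trans (sum-cong-≗ f≗g) (sym (weight≡sum g)))

sum-mono-≤ : ∀ {n} {f g : Fin n → ℕ} → (∀ i → f i ≤ g i) → sum f ≤ sum g
sum-mono-≤ {zero}  f≤g = z≤n
sum-mono-≤ {suc n} f≤g = +-mono-≤ (f≤g zero) (sum-mono-≤ (f≤g ∘ suc))

sum-const : ∀ n b → sum {n} (λ _ → b) ≡ n * b
sum-const zero    b = refl
sum-const (suc n) b = cong (b +_) (sum-const n b)

sum-δ : ∀ {n} (j : Fin n) → sum (δ j) ≡ 1
sum-δ {suc n} j = begin
  sum (δ j)                       ≡⟨ sum-remove {i = j} (δ j) ⟩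
  δ j j + sum (removeAt (δ j) j)  ≡⟨ cong₂ _+_ δ-diag (sum-cong-≗ δ-punchIn) ⟩
  1 + sum {n} (λ _ → 0)           ≡⟨ cong suc (trans (sum-const n 0) (*-zeroʳ n)) ⟩
  1                               ∎
  where
  open ≡-Reasoning
  δ-diag : δ j j ≡ 1
  δ-diag = cong (if_then 1 else 0) (dec-true (j ≟ j) refl)
  δ-punchIn : ∀ i → δ j (punchIn j i) ≡ 0
  δ-punchIn i = cong (if_then 1 else 0) (dec-false (punchIn j i ≟ j) (punchInᵢ≢i j i))

sum-↑ : ∀ m p (f : Fin (m + p) → ℕ) →
        sum f ≡ sum (λ i → f (i ↑ˡ p)) + sum (λ j → f (m ↑ʳ j))
sum-↑ zero    p f = refl
sum-↑ (suc m) p f = trans (cong (f zero +_) (sum-↑ m p (f ∘ suc))) (sym (+-assoc (f zero) _ _))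

sum-combine : ∀ n m (f : Fin (n * m) → ℕ) →
              sum f ≡ sum {n} (λ i → sum {m} (λ x → f (combine i x)))
sum-combine zero    m f = refl
sum-combine (suc n) m f =
  trans (sum-↑ m (n * m) f) (cong (sum (λ x → f (x ↑ˡ (n * m))) +_) (sum-combine n m (f ∘ (m ↑ʳ_))))

data RootView {k} (v : Fin (suc k)) : Fin (suc k) → Set where
  root    : RootView v v
  nonroot : ∀ y → RootView v (punchIn v y)

rootView : ∀ {k} (v x : Fin (suc k)) → RootView v x
rootView v x with v ≟ x
... | yes refl = root
... | no v≢x   = subst (RootView v) (punchIn-punchOut v≢x) (nonroot (punchOut v≢x))

IsRDFExcept : ∀ {m} → Graph m → Fin m → (Fin m → ℕ) → Set
IsRDFExcept H v f =
  (∀ x → f x ≤ 2) × (∀ x → x ≢ v → f x ≡ 0 → ∃ λ y → Adj H x y × f y ≡ 2)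

module _ {k} (H : Graph (suc k)) (v : Fin (suc k)) where

  weight-insertAt : ∀ (g : Fin k → ℕ) t → weight (insertAt g v t) ≡ t + weight g
  weight-insertAt g t = begin
    weight (insertAt g v t)                          ≡⟨ weight≡sum (insertAt g v t) ⟩
    sum (insertAt g v t)                             ≡⟨ sum-remove {i = v} (insertAt g v t) ⟩
    insertAt g v t v + sum (insertAt g v t ∘ punchIn v)
      ≡⟨ cong₂ _+_ (insertAt-lookup g v t) (sum-cong-≗ (insertAt-punchIn g v t)) ⟩
    t + sum g                                        ≡⟨ cong (t +_) (weight≡sum g) ⟨
    t + weight g                                     ∎
    where open ≡-Reasoning

  weight-removeAt-≤ : ∀ (f : Fin (suc k) → ℕ) → weight (removeAt f v) ≤ weight f
  weight-removeAt-≤ f = begin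
    weight (removeAt f v)          ≡⟨ weight≡sum (removeAt f v) ⟩
    sum (removeAt f v)             ≤⟨ m≤n+m (sum (removeAt f v)) (f v) ⟩
    f v + sum (removeAt f v)       ≡⟨ sum-remove {i = v} f ⟨
    sum f                          ≡⟨ weight≡sum f ⟨
    weight f                       ∎
    where open ≤-Reasoning

  isRDFExcept-dominated : ∀ {f} → IsRDFExcept H v f → ∀ x → f x ≡ 0 →
                          (∃ λ y → Adj H x y × f y ≡ 2) ⊎ x ≡ v
  isRDFExcept-dominated (_ , dom) x fx≡0 with rootView v x
  ... | root      = inj₂ refl
  ... | nonroot y = inj₁ (dom x (punchInᵢ≢i v y) fx≡0)

  isRDFExcept⇒isRDF : ∀ {f} → IsRDFExcept H v f → f v ≢ 0 → IsRDF H f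
  isRDFExcept⇒isRDF {f} rf@(f≤2 , _) fv≢0 = f≤2 , dominated
    where
    dominated : ∀ x → f x ≡ 0 → ∃ λ y → Adj H x y × f y ≡ 2
    dominated x fx≡0 with isRDFExcept-dominated rf x fx≡0
    ... | inj₁ r    = r
    ... | inj₂ refl = contradiction fx≡0 fv≢0

  isRDFExcept⇒removeAt-isRDF : ∀ {f} → IsRDFExcept H v f → f v ≡ 0 →
                               IsRDF (deleteVertex H v) (removeAt f v)
  isRDFExcept⇒removeAt-isRDF {f} (f≤2 , dom) fv≡0 = f≤2 ∘ punchIn v , dominated
    where
    avoidRoot : ∀ {y} → (∃ λ z → Adj H (punchIn v y) z × f z ≡ 2) →
                ∃ λ y′ → Adj H (punchIn v y) (punchIn v y′) × f (punchIn v y′) ≡ 2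
    avoidRoot (z , yz , fz≡2) with rootView v z
    ... | root       = contradiction (trans (sym fv≡0) fz≡2) λ ()
    ... | nonroot y′ = y′ , yz , fz≡2
    dominated : ∀ y → f (punchIn v y) ≡ 0 →
                ∃ λ y′ → Adj H (punchIn v y) (punchIn v y′) × f (punchIn v y′) ≡ 2
    dominated y fy≡0 = avoidRoot (dom (punchIn v y) (punchInᵢ≢i v y) fy≡0)

  insertAt-isRDFExcept : ∀ {g t} → IsRDF (deleteVertex H v) g → t ≤ 2 →
                         IsRDFExcept H v (insertAt g v t)
  insertAt-isRDFExcept {g} {t} (g≤2 , dom) t≤2 = bounded , dominated
    where
    bounded : ∀ x → insertAt g v t x ≤ 2
    bounded x with rootView v x
    ... | root      = subst (_≤ 2) (sym (insertAt-lookup g v t)) t≤2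
    ... | nonroot y = subst (_≤ 2) (sym (insertAt-punchIn g v t y)) (g≤2 y)
    dominated : ∀ x → x ≢ v → insertAt g v t x ≡ 0 →
                ∃ λ y → Adj H x y × insertAt g v t y ≡ 2
    dominated x x≢v fx≡0 with rootView v x
    ... | root = contradiction refl x≢v
    ... | nonroot y with dom y (trans (sym (insertAt-punchIn g v t y)) fx≡0)
    ...   | y′ , yy′ , gy′≡2 = punchIn v y′ , yy′ , trans (insertAt-punchIn g v t y′) gy′≡2

  γR-≤-isRDFExcept : ∀ {b c f} → IsRomanDomNumber H b →
                     IsRomanDomNumber (deleteVertex H v) c → b ≤ c →
                     IsRDFExcept H v f → b ≤ weight f
  γR-≤-isRDFExcept {b} {c} {f} (_ , b-min) (_ , c-min) b≤c rf with f v ≟ℕ 0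
  ... | no fv≢0  = b-min f (isRDFExcept⇒isRDF rf fv≢0)
  ... | yes fv≡0 = begin
    b                      ≤⟨ b≤c ⟩
    c                      ≤⟨ c-min _ (isRDFExcept⇒removeAt-isRDF rf fv≡0) ⟩
    weight (removeAt f v)  ≤⟨ weight-removeAt-≤ f ⟩
    weight f               ∎
    where open ≤-Reasoning

  γR-≤-suc-γR-deleteVertex : ∀ {b c} → IsRomanDomNumber H b →
                             IsRomanDomNumber (deleteVertex H v) c → b ≤ suc c
  γR-≤-suc-γR-deleteVertex {b} {c} (_ , b-min) ((g , rg , wg≡c) , _) = begin
    b                        ≤⟨ b-min _ (isRDFExcept⇒isRDF (insertAt-isRDFExcept rg (s≤s z≤n)) root≢0) ⟩
    weight (insertAt g v 1)  ≡⟨ weight-insertAt g 1 ⟩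
    suc (weight g)           ≡⟨ cong suc wg≡c ⟩
    suc c                    ∎
    where
    open ≤-Reasoning
    root≢0 : insertAt g v 1 v ≢ 0
    root≢0 = subst (_≢ 0) (sym (insertAt-lookup g v 1)) λ ()

copyOf : ∀ {n m} → (Fin (n * m) → ℕ) → Fin n → Fin m → ℕ
copyOf F i x = F (combine i x)

glue : ∀ {n m} → (Fin n → Fin m → ℕ) → Fin (n * m) → ℕ
glue {n} {m} h a = uncurry h (remQuot {n} m a)

copyOf-glue : ∀ {n m} (h : Fin n → Fin m → ℕ) i → copyOf (glue h) i ≗ h i
copyOf-glue h i x = cong (uncurry h) (remQuot-combine i x)

weight-copies : ∀ {n m} (F : Fin (n * m) → ℕ) →
                weight F ≡ sum {n} (λ i → weight {m} (copyOf F i))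
weight-copies {n} {m} F = begin
  weight F                                 ≡⟨ weight≡sum F ⟩
  sum F                                    ≡⟨ sum-combine n m F ⟩
  sum {n} (λ i → sum {m} (copyOf F i))     ≡⟨ sum-cong-≗ (λ i → weight≡sum (copyOf {n} F i)) ⟨
  sum {n} (λ i → weight {m} (copyOf F i))  ∎
  where open ≡-Reasoning

weight-glue : ∀ {n m} (h : Fin n → Fin m → ℕ) → weight (glue h) ≡ sum (λ i → weight (h i))
weight-glue {n} h =
  trans (weight-copies {n} (glue h)) (sum-cong-≗ (λ i → weight-cong (copyOf-glue h i)))

module _ {n k} (G : Graph n) (H : Graph (suc k)) (v : Fin (suc k)) where

  private
    P : Graph (n * suc k)
    P = rootedProduct G H v

  -- IsRDF P (glue h), read through the identification of vertex (i , x) of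
  -- G ∘ᵥ H with vertex x of the i-th copy of H.
  IsCopywiseRDF : (Fin n → Fin (suc k) → ℕ) → Set
  IsCopywiseRDF h = (∀ i x → h i x ≤ 2)
    × (∀ i x → h i x ≡ 0 → (∃ λ y → Adj H x y × h i y ≡ 2)
                          ⊎ (x ≡ v × ∃ λ j → Adj G i j × h j v ≡ 2))

  glue-isRDF : ∀ {h} → IsCopywiseRDF h → IsRDF P (glue h)
  glue-isRDF {h} (h≤2 , dom) = (λ a → h≤2 _ _) , dominated
    where
    towards : ∀ a j y → RPAdj G H v (remQuot {n} (suc k) a) (j , y) → h j y ≡ 2 →
              ∃ λ w → Adj P a w × glue h w ≡ 2
    towards a j y adj hjy≡2 =
      combine j y , subst (RPAdj G H v (remQuot {n} (suc k) a)) (sym (remQuot-combine j y)) adj ,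
      trans (copyOf-glue h j y) hjy≡2
    dominated : ∀ a → glue h a ≡ 0 → ∃ λ w → Adj P a w × glue h w ≡ 2
    dominated a ha≡0 with dom _ _ ha≡0
    ... | inj₁ (y , xy , hy≡2)       = towards a _ y (inj₁ (refl , xy)) hy≡2
    ... | inj₂ (x≡v , j , ij , hj≡2) = towards a j v (inj₂ (x≡v , refl , ij)) hj≡2

  copyOf-isRDFExcept : ∀ {F} → IsRDF P F → ∀ i → IsRDFExcept H v (copyOf F i)
  copyOf-isRDFExcept {F} (F≤2 , dom) i = F≤2 ∘ combine i , dominated
    where
    dominated : ∀ x → x ≢ v → F (combine i x) ≡ 0 → ∃ λ y → Adj H x y × F (combine i y) ≡ 2
    dominated x x≢v Fix≡0 with dom (combine i x) Fix≡0
    ... | w , adj , Fw≡2 =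
      inCopy (subst (λ p → RPAdj G H v p (remQuot {n} (suc k) w)) (remQuot-combine i x) adj)
      where
      inCopy : RPAdj G H v (i , x) (remQuot {n} (suc k) w) →
               ∃ λ y → Adj H x y × F (combine i y) ≡ 2
      inCopy (inj₁ (refl , xy)) = _ , xy , trans (cong F (combine-remQuot {n} (suc k) w)) Fw≡2
      inCopy (inj₂ (x≡v , _))   = contradiction x≡v x≢v

  γR-rootedProduct-≤ : ∀ {a b} → IsRomanDomNumber P a → IsRomanDomNumber H b → a ≤ n * b
  γR-rootedProduct-≤ {a} {b} (_ , a-min) ((f , (f≤2 , dom) , wf≡b) , _) = begin
    a                          ≤⟨ a-min _ (glue-isRDF ((λ _ → f≤2) , λ _ x fx≡0 → inj₁ (dom x fx≡0))) ⟩
    weight (glue {n} λ _ → f)  ≡⟨ weight-glue {n} (λ _ → f) ⟩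
    sum {n} (λ _ → weight f)   ≡⟨ cong (λ w → sum {n} λ _ → w) wf≡b ⟩
    sum {n} (λ _ → b)          ≡⟨ sum-const n b ⟩
    n * b                      ∎
    where open ≤-Reasoning

  γR-rootedProduct-≥ : ∀ {a b c} → IsRomanDomNumber P a → IsRomanDomNumber H b →
                       IsRomanDomNumber (deleteVertex H v) c → b ≤ c → n * b ≤ a
  γR-rootedProduct-≥ {a} {b} ((F , rF , wF≡a) , _) γH γH-v b≤c = begin
    n * b                                ≡⟨ sum-const n b ⟨
    sum {n} (λ _ → b)
      ≤⟨ sum-mono-≤ (λ i → γR-≤-isRDFExcept H v γH γH-v b≤c (copyOf-isRDFExcept rF i)) ⟩
    sum {n} (λ i → weight (copyOf F i))  ≡⟨ weight-copies {n} F ⟨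
    weight F                             ≡⟨ wF≡a ⟩
    a                                    ∎
    where open ≤-Reasoning

module TwoNeighbours {n k} (G : Graph n) (H : Graph (suc k)) (v : Fin (suc k))
  {u w₁ w₂ : Fin n} (uw₁ : Adj G u w₁) (uw₂ : Adj G u w₂) (w₁≢w₂ : w₁ ≢ w₂)
  {f : Fin (suc k) → ℕ} (rf : IsRDF H f)
  {g : Fin k → ℕ} (rg : IsRDF (deleteVertex H v) g) (wf≡1+wg : weight f ≡ suc (weight g))
  where

  centre leaf : Fin (suc k) → ℕ
  centre = insertAt g v 2
  leaf   = insertAt g v 0

  choose : ∀ {i} → Dec (i ≡ u) → Dec (i ≡ w₁) → Dec (i ≡ w₂) → Fin (suc k) → ℕ
  choose (yes _) _       _       = centre
  choose (no _)  (yes _) _       = leaf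
  choose (no _)  (no _)  (yes _) = leaf
  choose (no _)  (no _)  (no _)  = f

  copies : Fin n → Fin (suc k) → ℕ
  copies i = choose (i ≟ u) (i ≟ w₁) (i ≟ w₂)

  centre-isRDFExcept : IsRDFExcept H v centre
  centre-isRDFExcept = insertAt-isRDFExcept H v rg ≤-refl

  leaf-isRDFExcept : IsRDFExcept H v leaf
  leaf-isRDFExcept = insertAt-isRDFExcept H v rg z≤n

  copies-u-root : copies u v ≡ 2
  copies-u-root = choose-root (u ≟ u) (u ≟ w₁) (u ≟ w₂)
    where
    choose-root : (d₁ : Dec (u ≡ u)) (d₂ : Dec (u ≡ w₁)) (d₃ : Dec (u ≡ w₂)) →
                  choose d₁ d₂ d₃ v ≡ 2
    choose-root (yes _)  _ _ = insertAt-lookup g v 2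
    choose-root (no u≢u) _ _ = contradiction refl u≢u

  choose-≤2 : ∀ {i} (d₁ : Dec (i ≡ u)) (d₂ : Dec (i ≡ w₁)) (d₃ : Dec (i ≡ w₂)) x →
              choose d₁ d₂ d₃ x ≤ 2
  choose-≤2 (yes _) _       _       = proj₁ centre-isRDFExcept
  choose-≤2 (no _)  (yes _) _       = proj₁ leaf-isRDFExcept
  choose-≤2 (no _)  (no _)  (yes _) = proj₁ leaf-isRDFExcept
  choose-≤2 (no _)  (no _)  (no _)  = proj₁ rf

  leaf-dominated : ∀ {i} → Adj G i u → ∀ x → leaf x ≡ 0 →
                   (∃ λ y → Adj H x y × leaf y ≡ 2) ⊎ (x ≡ v × ∃ λ j → Adj G i j × copies j v ≡ 2)
  leaf-dominated iu x lx≡0 with isRDFExcept-dominated H v leaf-isRDFExcept x lx≡0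
  ... | inj₁ r   = inj₁ r
  ... | inj₂ x≡v = inj₂ (x≡v , u , iu , copies-u-root)

  choose-dominated : ∀ {i} (d₁ : Dec (i ≡ u)) (d₂ : Dec (i ≡ w₁)) (d₃ : Dec (i ≡ w₂)) x →
                     choose d₁ d₂ d₃ x ≡ 0 →
                     (∃ λ y → Adj H x y × choose d₁ d₂ d₃ y ≡ 2)
                     ⊎ (x ≡ v × ∃ λ j → Adj G i j × copies j v ≡ 2)
  choose-dominated (yes _) _ _ x cx≡0 with isRDFExcept-dominated H v centre-isRDFExcept x cx≡0
  ... | inj₁ r    = inj₁ r
  ... | inj₂ refl = contradiction cx≡0 (subst (_≢ 0) (sym (insertAt-lookup g v 2)) λ ())
  choose-dominated (no _) (yes refl) _          = leaf-dominated (Graph.sym G uw₁)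
  choose-dominated (no _) (no _)     (yes refl) = leaf-dominated (Graph.sym G uw₂)
  choose-dominated (no _) (no _)     (no _) x fx≡0 = inj₁ (proj₂ rf x fx≡0)

  copies-isCopywiseRDF : IsCopywiseRDF G H v copies
  copies-isCopywiseRDF = (λ i → choose-≤2 (i ≟ u) (i ≟ w₁) (i ≟ w₂))
                       , (λ i → choose-dominated (i ≟ u) (i ≟ w₁) (i ≟ w₂))

  -- Copy u weighs weight f + 1 and copies w₁, w₂ weigh weight f - 1 each.
  choose-balance : ∀ {i} (d₁ : Dec (i ≡ u)) (d₂ : Dec (i ≡ w₁)) (d₃ : Dec (i ≡ w₂)) →
                   [ d₂ ] + [ d₃ ] + weight (choose d₁ d₂ d₃) ≡ [ d₁ ] + weight f
  choose-balance (yes refl) (yes u≡w₁) _          = contradiction u≡w₁ (Adj⇒≢ G uw₁)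
  choose-balance (yes refl) (no _)     (yes u≡w₂) = contradiction u≡w₂ (Adj⇒≢ G uw₂)
  choose-balance (yes refl) (no _)     (no _)     =
    trans (weight-insertAt H v g 2) (cong suc (sym wf≡1+wg))
  choose-balance (no _)     (yes refl) (yes w₁≡w₂) = contradiction w₁≡w₂ w₁≢w₂
  choose-balance (no _)     (yes _)    (no _)     =
    trans (cong suc (weight-insertAt H v g 0)) (sym wf≡1+wg)
  choose-balance (no _)     (no _)     (yes _)    =
    trans (cong suc (weight-insertAt H v g 0)) (sym wf≡1+wg)
  choose-balance (no _)     (no _)     (no _)     = refl

  suc-weight-glue-copies : suc (weight (glue copies)) ≡ n * weight f
  suc-weight-glue-copies = suc-injective (begin
    2 + weight (glue copies)                            ≡⟨ cong (2 +_) (weight-glue {n} copies) ⟩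
    1 + 1 + S                                           ≡⟨ cong₂ (λ p q → p + q + S) (sum-δ w₁) (sum-δ w₂) ⟨
    sum (δ w₁) + sum (δ w₂) + S                         ≡⟨ cong (_+ S) (∑-distrib-+ (δ w₁) (δ w₂)) ⟨
    sum (λ i → δ w₁ i + δ w₂ i) + S                     ≡⟨ ∑-distrib-+ (λ i → δ w₁ i + δ w₂ i) _ ⟨
    sum (λ i → δ w₁ i + δ w₂ i + weight (copies i))     ≡⟨ sum-cong-≗ (λ i → choose-balance (i ≟ u) (i ≟ w₁) (i ≟ w₂)) ⟩
    sum (λ i → δ u i + weight f)                        ≡⟨ ∑-distrib-+ (δ u) _ ⟩
    sum (δ u) + sum {n} (λ _ → weight f)                ≡⟨ cong₂ _+_ (sum-δ u) (sum-const n (weight f)) ⟩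
    1 + n * weight f                                    ∎)
    where
    open ≡-Reasoning
    S : ℕ
    S = sum (λ i → weight (copies i))

  lighterRDF : ∃ λ F → IsRDF (rootedProduct G H v) F × weight F < n * weight f
  lighterRDF = glue copies , glue-isRDF G H v copies-isCopywiseRDF , ≤-reflexive suc-weight-glue-copies

theorem3p8 : ∀ {n k : ℕ} (G : Graph n) (H : Graph (suc k)) (v : Fin (suc k))
    → NoIsolated G → ¬ DisjointUnionK2 G → k ≥ 1
    → ∀ (a b c : ℕ)
    → IsRomanDomNumber (rootedProduct G H v) a
    → IsRomanDomNumber H b
    → IsRomanDomNumber (deleteVertex H v) c
    → ((a ≡ n * b → c ≥ b) × (c ≥ b → a ≡ n * b))
theorem3p8 {n} G H v noIsolated ¬K2 _ a b c γP@(_ , a-min)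
           γH@((f , rf , wf≡b) , _) γH-v@((g , rg , wg≡c) , _) = only-if , if
  where
  if : c ≥ b → a ≡ n * b
  if b≤c = ≤-antisym (γR-rootedProduct-≤ G H v γP γH) (γR-rootedProduct-≥ G H v γP γH γH-v b≤c)

  only-if : a ≡ n * b → c ≥ b
  only-if a≡nb with b ≤? c
  ... | yes b≤c = b≤c
  ... | no  b≰c = contradiction disjointUnionK2 ¬K2
    where
    wf≡1+wg : weight f ≡ suc (weight g)
    wf≡1+wg = trans wf≡b (trans (≤-antisym (γR-≤-suc-γR-deleteVertex H v γH γH-v) (≰⇒> b≰c))
                                (cong suc (sym wg≡c)))
    uniqueNeighbour : ∀ {x y₁ y₂} → Adj G x y₁ → Adj G x y₂ → y₁ ≡ y₂
    uniqueNeighbour xy₁ xy₂ = decidable-stable (_ ≟ _) λ y₁≢y₂ →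
      let (F , rF , wF<nwf) = TwoNeighbours.lighterRDF G H v xy₁ xy₂ y₁≢y₂ rf rg wf≡1+wg
      in <-irrefl a≡nb (≤-<-trans (a-min F rF) (subst (λ w → weight F < n * w) wf≡b wF<nwf))
    disjointUnionK2 : DisjointUnionK2 G
    disjointUnionK2 x = let (y , xy) = noIsolated x in y , xy , λ y′ xy′ → uniqueNeighbour xy′ xy
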